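{- Let $G$ be a simple, connected, undirected graph with vertex set $V=\{1,\ldots,n\}$. Then $G$ contains an internally complete set, i.e. a maximal independent set $S$ with $Int(S)=S$.
   Context: The labels give the linear order on $V$; $N(v)$ is the neighbourhood of $v$. For an independent set $A$ and $v\in A$, $Subs(v)=\{u\in N(v): (A\setminus\{v\})\cup\{u\}\text{ is independent}\}$; $v$ is internally active in $A$ if $Subs(v)=\emptyset$, or $Subs(v)\neq\emptyset$ and $v>\max Subs(v)$. $Int(A)$ is the set of internally active vertices of $A$. A maximal independent set $S$ is internally complete if $Int(S)=S$. -}

module Defs where

open import Data.Nat using (ℕ)
open import Data.Fin using (Fin; _<_)
open import Data.Fin.Subset using (Subset; _∈_; _∉_; _∪_; ⁅_⁆; _-_)
open import Data.Product using (Σ; ∃; _×_)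
open import Data.Sum using (_⊎_)
open import Data.Empty using (⊥)
open import Data.List using (List; []; _∷_)
open import Relation.Nullary using (¬_; Dec)
open import Relation.Binary.PropositionalEquality using (_≡_)
open import Level using (0ℓ) renaming (suc to lsuc)

-- A simple undirected graph on the vertex set Fin n (labels 0..n-1, with
-- their usual order playing the role of 1..n).
record SimpleGraph (n : ℕ) : Set₁ where
  field
    Adj   : Fin n → Fin n → Set
    sym   : ∀ {u v} → Adj u v → Adj v u
    irrefl : ∀ {v} → ¬ Adj v v
    adj?   : ∀ u v → Dec (Adj u v)

open SimpleGraph public

data Walk {n : ℕ} (G : SimpleGraph n) : Fin n → Fin n → Set where
  nil  : ∀ {v} → Walk G v v
  cons : ∀ {u w v} → Adj G u w → Walk G w v → Walk G u v

Connected : ∀ {n} → SimpleGraph n → Set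
Connected {n} G = ∀ (u v : Fin n) → Walk G u v

Independent : ∀ {n} → SimpleGraph n → Subset n → Set
Independent G A = ∀ {u v} → u ∈ A → v ∈ A → ¬ Adj G u v

MaximalIndependent : ∀ {n} → SimpleGraph n → Subset n → Set
MaximalIndependent {n} G A =
  Independent G A × (∀ (v : Fin n) → v ∉ A → ¬ Independent G (A ∪ ⁅ v ⁆))

Subs : ∀ {n} → SimpleGraph n → Subset n → Fin n → Fin n → Set
Subs G A v u = Adj G v u × Independent G ((A - v) ∪ ⁅ u ⁆)

InternallyActive : ∀ {n} → SimpleGraph n → Subset n → Fin n → Set
InternallyActive {n} G A v =
  (∀ (u : Fin n) → ¬ Subs G A v u)
  ⊎ ((∃ λ (u : Fin n) → Subs G A v u) × (∀ (u : Fin n) → Subs G A v u → u < v))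

Int : ∀ {n} → SimpleGraph n → Subset n → Fin n → Set
Int G A v = v ∈ A × InternallyActive G A v

InternallyComplete : ∀ {n} → SimpleGraph n → Subset n → Set
InternallyComplete {n} G S =
  MaximalIndependent G S × (∀ (v : Fin n) → (Int G S v → v ∈ S) × (v ∈ S → Int G S v))

-- Build S greedily from the largest vertex down, adding a vertex whenever it has
-- no neighbour already chosen. Then every vertex outside S has a larger
-- neighbour in S. If v ∈ S and u ∈ Subs(v) with u > v, that larger neighbour of
-- u lies in S - v, so (S - v) ∪ {u} is not independent; hence Subs(v) lies
-- below v and every vertex of S is internally active.
module Submission where

open import Data.Nat using (ℕ; zero; suc; z<s; s<s)
open import Data.Product using (∃; _×_; _,_)
open import Data.Sum using (inj₁; inj₂)
open import Data.Empty using (⊥-elim)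
open import Data.Vec using ([]; _∷_; here; there)
open import Data.Fin using (Fin; zero; suc; _<_)
open import Data.Fin.Properties using (any?; all?; <-cmp; <-asym)
open import Data.Fin.Subset using (Subset; _∈_; _∉_; _∪_; ⁅_⁆; _-_; inside; outside)
open import Data.Fin.Subset.Properties using (_∈?_; x∈⁅x⁆; x∈p∪q⁺; x∈p∧x≢y⇒x∈p-y)
open import Relation.Nullary using (¬_; Dec; yes; no)
open import Relation.Nullary.Decidable using (map′; _→-dec_; _×-dec_; ¬?)
open import Relation.Binary using (tri<; tri≈; tri>)
open import Relation.Binary.PropositionalEquality using (_≢_; refl)
open import Defs

UpwardDominating : ∀ {n} → SimpleGraph n → Subset n → Set
UpwardDominating G S = ∀ {u} → u ∉ S → ∃ λ w → w ∈ S × u < w × Adj G u w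

deleteZero : ∀ {n} → SimpleGraph (suc n) → SimpleGraph n
deleteZero G = record
  { Adj    = λ u v → Adj G (suc u) (suc v)
  ; sym    = sym G
  ; irrefl = irrefl G
  ; adj?   = λ u v → adj? G (suc u) (suc v)
  }

module _ {n : ℕ} (G : SimpleGraph (suc n)) {S : Subset n} where

  upwardDominating-∷ : UpwardDominating (deleteZero G) S →
    ∀ {b u} → suc u ∉ b ∷ S → ∃ λ w → w ∈ b ∷ S × suc u < w × Adj G (suc u) w
  upwardDominating-∷ dom suc-u∉ with dom (λ u∈ → suc-u∉ (there u∈))
  ... | w , w∈ , u<w , adj = suc w , there w∈ , s<s u<w , adj

  independent-outside∷ : Independent (deleteZero G) S → Independent G (outside ∷ S)
  independent-outside∷ ind (there u∈) (there v∈) = ind u∈ v∈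

  independent-inside∷ : Independent (deleteZero G) S →
    (∀ {w} → w ∈ S → ¬ Adj G zero (suc w)) → Independent G (inside ∷ S)
  independent-inside∷ ind zero-isolated here      here      = irrefl G
  independent-inside∷ ind zero-isolated here      (there v∈) = zero-isolated v∈
  independent-inside∷ ind zero-isolated (there u∈) here      = λ adj → zero-isolated u∈ (sym G adj)
  independent-inside∷ ind zero-isolated (there u∈) (there v∈) = ind u∈ v∈

greedyIndependent : ∀ {n} (G : SimpleGraph n) →
  ∃ λ S → Independent G S × UpwardDominating G S
greedyIndependent {zero}  G = [] , (λ ()) , λ { {()} }
greedyIndependent {suc n} G
  with greedyIndependent (deleteZero G)
... | S , ind , dom
  with any? (λ w → (w ∈? S) ×-dec adj? G zero (suc w))
...  | yes (w , w∈ , adj) = outside ∷ S , independent-outside∷ G ind , dominating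
  where
    dominating : UpwardDominating G (outside ∷ S)
    dominating {zero}  _   = suc w , there w∈ , z<s , adj
    dominating {suc u} u∉ = upwardDominating-∷ G dom u∉
...  | no zero-isolated =
  inside ∷ S , independent-inside∷ G ind (λ w∈ adj → zero-isolated (_ , w∈ , adj)) , dominating
  where
    dominating : UpwardDominating G (inside ∷ S)
    dominating {zero}  0∉ = ⊥-elim (0∉ here)
    dominating {suc u} u∉ = upwardDominating-∷ G dom u∉

independent? : ∀ {n} (G : SimpleGraph n) (A : Subset n) → Dec (Independent G A)
independent? G A = map′ (λ f {u} {v} → f u v) (λ f u v → f)
  (all? λ u → all? λ v → (u ∈? A) →-dec ((v ∈? A) →-dec ¬? (adj? G u v)))

subs? : ∀ {n} (G : SimpleGraph n) (A : Subset n) (v u : Fin n) → Dec (Subs G A v u)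
subs? G A v u = adj? G v u ×-dec independent? G ((A - v) ∪ ⁅ u ⁆)

module _ {n : ℕ} (G : SimpleGraph n) {S : Subset n}
         (ind : Independent G S) (dom : UpwardDominating G S) where

  upwardDominating⇒maximal : MaximalIndependent G S
  upwardDominating⇒maximal = ind , not-extendable
    where
      not-extendable : ∀ v → v ∉ S → ¬ Independent G (S ∪ ⁅ v ⁆)
      not-extendable v v∉ ind-v with dom v∉
      ... | w , w∈ , _ , adj = ind-v (x∈p∪q⁺ (inj₂ (x∈⁅x⁆ v))) (x∈p∪q⁺ (inj₁ w∈)) adj

  subs⇒< : ∀ {v u} → v ∈ S → Subs G S v u → u < v
  subs⇒< {v} {u} v∈ (adj , ind-swap) with dom (λ u∈ → ind v∈ u∈ adj)
  ... | w , w∈ , u<w , adj-uw with <-cmp u v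
  ...   | tri< u<v _ _ = u<v
  ...   | tri≈ _ refl _ = ⊥-elim (irrefl G adj)
  ...   | tri> _ _ v<u = ⊥-elim (ind-swap w∈S-v (x∈p∪q⁺ (inj₂ (x∈⁅x⁆ u))) (sym G adj-uw))
    where
      w≢v : w ≢ v
      w≢v refl = <-asym v<u u<w
      w∈S-v : w ∈ (S - v) ∪ ⁅ u ⁆
      w∈S-v = x∈p∪q⁺ (inj₁ (x∈p∧x≢y⇒x∈p-y w∈ w≢v))

  internallyActive : ∀ {v} → v ∈ S → InternallyActive G S v
  internallyActive {v} v∈ with any? (subs? G S v)
  ... | yes subs-nonempty = inj₂ (subs-nonempty , λ u → subs⇒< v∈)
  ... | no  subs-empty    = inj₁ λ u s → subs-empty (u , s)

  upwardDominating⇒internallyComplete : InternallyComplete G S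
  upwardDominating⇒internallyComplete =
    upwardDominating⇒maximal , λ v → (λ (v∈ , _) → v∈) , λ v∈ → v∈ , internallyActive v∈

theorem3 : ∀ (n : ℕ) (G : SimpleGraph n) → Connected G →
    ∃ λ S → InternallyComplete G S
theorem3 n G _ with greedyIndependent G
... | S , ind , dom = S , upwardDominating⇒internallyComplete G ind dom
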